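{- Let $G\subset S_n$ be a transitive subgroup, and suppose $G$ contains exactly $m$ transpositions of the form $(1,i)$. Then $m+1$ divides $n$. -}

module Defs where

open import Data.Nat using (ℕ; suc)
open import Data.Fin using (Fin; zero; suc)
open import Data.Fin.Permutation using (Permutation′; _⟨$⟩ʳ_; _≈_; id; flip; _∘ₚ_; transpose)
open import Data.List using (length; filter; allFin)
open import Data.Product using (Σ; _×_)
open import Relation.Nullary using (Dec)
open import Relation.Binary.PropositionalEquality using (_≡_)

record IsSubgroup {n : ℕ} (G : Permutation′ n → Set) : Set where
  field
    respects : ∀ {σ τ} → σ ≈ τ → G σ → G τ
    has-id   : G id
    closed-∘ : ∀ {σ τ} → G σ → G τ → G (σ ∘ₚ τ)
    closed-⁻¹ : ∀ {σ} → G σ → G (flip σ)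

IsTransitive : {n : ℕ} → (Permutation′ n → Set) → Set
IsTransitive {n} G = ∀ (i j : Fin n) → Σ (Permutation′ n) (λ σ → G σ × (σ ⟨$⟩ʳ i ≡ j))

-- Number of transpositions (0, i) with i ≠ 0 lying in G, a subgroup of S_(suc n).
-- (The paper's point 1 is Fin's zero; the other points are suc i for i : Fin n.)
transpCount : {n : ℕ} (G : Permutation′ (suc n) → Set) →
              (∀ σ → Dec (G σ)) → ℕ
transpCount {n} G G? = length (filter (λ i → G? (transpose zero (suc i))) (allFin n))

{-# OPTIONS --safe #-}
-- Relate i and j when i = j or the transposition (i j) lies in G. Because G is a group
-- this is an equivalence relation (for distinct i, j, k, (i k) is the conjugate of (j k)
-- by (i j)), and G preserves it since σ (i j) σ⁻¹ = (σi σj). As G is transitive, every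
-- class therefore has the size of the class of the first point, which is m + 1; the
-- classes partition the n + 1 points, so m + 1 divides n + 1.
module Submission where

open import Defs
open import Level using (Level)
open import Data.Nat using (ℕ; zero; suc; _+_; _<_)
open import Data.Nat.Properties using (+-suc; +-0-commutativeMonoid)
open import Data.Nat.Divisibility using (_∣_; ∣-refl; ∣m∣n⇒∣m+n; _∣0)
open import Data.Nat.Induction using (<-wellFounded)
open import Data.Fin using (Fin; zero; suc; _≟_)
open import Data.Fin.Permutation
  using (Permutation′; _⟨$⟩ʳ_; _⟨$⟩ˡ_; _≈_; flip; _∘ₚ_; transpose; inverseˡ; inverseʳ)
import Data.Fin.Permutation.Components as PC
open import Data.List using (List; []; _∷_; length; filter; allFin; tabulate)
open import Data.List.Properties using (length-tabulate; filter-≐; filter-notAll; filter-reject)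
open import Data.List.Membership.Propositional using (_∈_)
open import Data.List.Membership.Propositional.Properties using (∈-filter⁻)
open import Data.List.Relation.Unary.Any using (here)
open import Data.Product using (_,_)
open import Data.Sum using (_⊎_; inj₁; inj₂)
open import Function using (_∘_)
open import Induction.WellFounded using (Acc; acc)
open import Relation.Nullary using (Dec; yes; no; contradiction)
open import Relation.Nullary.Decidable using (_⊎-dec_)
open import Relation.Unary using (Pred; Decidable; _⊆_; _≐_)
open import Relation.Unary.Properties using (∁?)
import Relation.Binary as B
open import Relation.Binary.PropositionalEquality
open import Algebra.Properties.CommutativeMonoid.Sum +-0-commutativeMonoid
  using (sum; sum-permute)

private
  variable
    a p q ℓ : Level
    A : Set a
    N : ℕ

indicator : {P : Set p} → Dec P → ℕ
indicator (yes _) = 1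
indicator (no _)  = 0

indicator-yes : {P : Set p} → P → (P? : Dec P) → indicator P? ≡ 1
indicator-yes _  (yes _) = refl
indicator-yes px (no ¬px) = contradiction px ¬px

module _ {P : Pred A p} (P? : Decidable P) where

  length-filter+length-filter-∁ : ∀ xs →
    length (filter P? xs) + length (filter (∁? P?) xs) ≡ length xs
  length-filter+length-filter-∁ []       = refl
  length-filter+length-filter-∁ (x ∷ xs) with P? x
  ... | yes _ = cong suc (length-filter+length-filter-∁ xs)
  ... | no _  = trans (+-suc _ _) (cong suc (length-filter+length-filter-∁ xs))

  filter-filter-⊆ : {Q : Pred A q} (Q? : Decidable Q) → Q ⊆ P → ∀ xs →
    filter Q? (filter P? xs) ≡ filter Q? xs
  filter-filter-⊆ Q? Q⊆P []       = refl
  filter-filter-⊆ Q? Q⊆P (x ∷ xs) with P? x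
  ... | no ¬px = trans (filter-filter-⊆ Q? Q⊆P xs) (sym (filter-reject Q? (¬px ∘ Q⊆P)))
  ... | yes _ with Q? x
  ...   | yes _ = cong (x ∷_) (filter-filter-⊆ Q? Q⊆P xs)
  ...   | no _  = filter-filter-⊆ Q? Q⊆P xs

module _ {R : B.Rel A ℓ} (R? : B.Decidable R) (R-equiv : B.IsEquivalence R) where
  open B.IsEquivalence R-equiv renaming (refl to R-refl; sym to R-sym; trans to R-trans)

  ∣length-of-equal-classes : ∀ k xs → (∀ {y} → y ∈ xs → length (filter (R? y) xs) ≡ k) →
                             k ∣ length xs
  ∣length-of-equal-classes k zs = go zs (<-wellFounded (length zs))
    where
    go : ∀ xs → Acc _<_ (length xs) →
         (∀ {y} → y ∈ xs → length (filter (R? y) xs) ≡ k) → k ∣ length xs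
    go []       _        _          = _ ∣0
    go (x ∷ xs) (acc rs) classSize =
      subst (k ∣_) length-split (∣m∣n⇒∣m+n ∣-refl (go rest (rs shorter) restClassSize))
      where
      rest : List _
      rest = filter (∁? (R? x)) (x ∷ xs)
      length-split : k + length rest ≡ length (x ∷ xs)
      length-split = trans (cong (_+ length rest) (sym (classSize (here refl))))
                           (length-filter+length-filter-∁ (R? x) (x ∷ xs))
      shorter : length rest < length (x ∷ xs)
      shorter = filter-notAll (∁? (R? x)) (x ∷ xs) (here (λ ¬Rxx → ¬Rxx R-refl))
      restClassSize : ∀ {y} → y ∈ rest → length (filter (R? y) rest) ≡ k
      restClassSize y∈rest with ∈-filter⁻ (∁? (R? x)) y∈rest
      ... | y∈xs , ¬Rxy =
        trans (cong length (filter-filter-⊆ (∁? (R? x)) (R? _)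
                              (λ Ryz Rxz → ¬Rxy (R-trans Rxz (R-sym Ryz))) (x ∷ xs)))
              (classSize y∈xs)

count : {P : Pred (Fin N) p} → Decidable P → ℕ
count {N} P? = length (filter P? (allFin N))

module _ {P : Pred A p} (P? : Decidable P) where

  length-filter-tabulate : (f : Fin N → A) →
    length (filter P? (tabulate f)) ≡ sum (indicator ∘ P? ∘ f)
  length-filter-tabulate {zero}  f = refl
  length-filter-tabulate {suc N} f with P? (f zero)
  ... | yes _ = cong suc (length-filter-tabulate (f ∘ suc))
  ... | no _  = length-filter-tabulate (f ∘ suc)

module _ {P : Pred (Fin N) p} (P? : Decidable P) where

  count≡sum : count P? ≡ sum (indicator ∘ P?)
  count≡sum = length-filter-tabulate P? (λ i → i)

  count-permute : (σ : Permutation′ N) → count (P? ∘ (σ ⟨$⟩ʳ_)) ≡ count P?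
  count-permute σ = begin
    count (P? ∘ (σ ⟨$⟩ʳ_))           ≡⟨ length-filter-tabulate (P? ∘ (σ ⟨$⟩ʳ_)) (λ i → i) ⟩
    sum (indicator ∘ P? ∘ (σ ⟨$⟩ʳ_)) ≡⟨ sum-permute (indicator ∘ P?) σ ⟨
    sum (indicator ∘ P?)             ≡⟨ count≡sum ⟨
    count P?                         ∎
    where open ≡-Reasoning

  count-cong : {Q : Pred (Fin N) q} (Q? : Decidable Q) → P ≐ Q → count P? ≡ count Q?
  count-cong Q? P≐Q = cong length (filter-≐ P? Q? P≐Q (allFin _))

count-suc : {P : Pred (Fin (suc N)) p} (P? : Decidable P) →
            count P? ≡ indicator (P? zero) + count (P? ∘ suc)
count-suc P? =
  trans (count≡sum P?) (cong (indicator (P? zero) +_) (sym (count≡sum (P? ∘ suc))))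

module _ (i j : Fin N) where

  transpose-matchˡ : PC.transpose i j i ≡ j
  transpose-matchˡ with i ≟ i
  ... | yes _  = refl
  ... | no i≢i = contradiction refl i≢i

  transpose-matchʳ : PC.transpose i j j ≡ i
  transpose-matchʳ with j ≟ i
  ... | yes j≡i = j≡i
  ... | no _ with j ≟ j
  ...   | yes _  = refl
  ...   | no j≢j = contradiction refl j≢j

  transpose-fix : ∀ {k} → k ≢ i → k ≢ j → PC.transpose i j k ≡ k
  transpose-fix {k} k≢i k≢j with k ≟ i
  ... | yes k≡i = contradiction k≡i k≢i
  ... | no _ with k ≟ j
  ...   | yes k≡j = contradiction k≡j k≢j
  ...   | no _    = refl

transpose-comm : (i j : Fin N) → transpose i j ≈ transpose j i
transpose-comm i j k = by-cases (k ≟ i) (k ≟ j)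
  where
  by-cases : Dec (k ≡ i) → Dec (k ≡ j) → PC.transpose i j k ≡ PC.transpose j i k
  by-cases (yes refl) _          = trans (transpose-matchˡ i j) (sym (transpose-matchʳ j i))
  by-cases (no _)     (yes refl) = trans (transpose-matchʳ i j) (sym (transpose-matchˡ j i))
  by-cases (no k≢i)   (no k≢j)   =
    trans (transpose-fix i j k≢i k≢j) (sym (transpose-fix j i k≢j k≢i))

transpose-natural : ∀ {M} (f : Fin N → Fin M) → (∀ {x y} → f x ≡ f y → x ≡ y) →
                    ∀ i j k → f (PC.transpose i j k) ≡ PC.transpose (f i) (f j) (f k)
transpose-natural f f-inj i j k = by-cases (k ≟ i) (k ≟ j)
  where
  by-cases : Dec (k ≡ i) → Dec (k ≡ j) →
             f (PC.transpose i j k) ≡ PC.transpose (f i) (f j) (f k)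
  by-cases (yes refl) _          =
    trans (cong f (transpose-matchˡ i j)) (sym (transpose-matchˡ (f i) (f j)))
  by-cases (no _)     (yes refl) =
    trans (cong f (transpose-matchʳ i j)) (sym (transpose-matchʳ (f i) (f j)))
  by-cases (no k≢i)   (no k≢j)   =
    trans (cong f (transpose-fix i j k≢i k≢j))
          (sym (transpose-fix (f i) (f j) (k≢i ∘ f-inj) (k≢j ∘ f-inj)))

transpose-conjugate : (σ : Permutation′ N) (i j : Fin N) →
                      flip σ ∘ₚ transpose i j ∘ₚ σ ≈ transpose (σ ⟨$⟩ʳ i) (σ ⟨$⟩ʳ j)
transpose-conjugate σ i j k = begin
  σ ⟨$⟩ʳ PC.transpose i j (σ ⟨$⟩ˡ k)
    ≡⟨ transpose-natural (σ ⟨$⟩ʳ_) σ-injective i j _ ⟩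
  PC.transpose (σ ⟨$⟩ʳ i) (σ ⟨$⟩ʳ j) (σ ⟨$⟩ʳ (σ ⟨$⟩ˡ k))
    ≡⟨ cong (PC.transpose _ _) (inverseʳ σ) ⟩
  PC.transpose (σ ⟨$⟩ʳ i) (σ ⟨$⟩ʳ j) k
    ∎
  where
  open ≡-Reasoning
  σ-injective : ∀ {x y} → σ ⟨$⟩ʳ x ≡ σ ⟨$⟩ʳ y → x ≡ y
  σ-injective e = trans (sym (inverseˡ σ)) (trans (cong (σ ⟨$⟩ˡ_) e) (inverseˡ σ))

Transposable : (Permutation′ N → Set) → Fin N → Fin N → Set
Transposable G i j = i ≡ j ⊎ G (transpose i j)

transposable? : {G : Permutation′ N → Set} → (∀ σ → Dec (G σ)) →
                B.Decidable (Transposable G)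
transposable? G? i j = (i ≟ j) ⊎-dec G? (transpose i j)

module _ {G : Permutation′ N → Set} (G-sub : IsSubgroup G) where
  open IsSubgroup G-sub

  conjugate-transpose-∈ : ∀ {σ i j} → G σ → G (transpose i j) →
                          G (transpose (σ ⟨$⟩ʳ i) (σ ⟨$⟩ʳ j))
  conjugate-transpose-∈ {σ} {i} {j} σ∈G τ∈G =
    respects (transpose-conjugate σ i j) (closed-∘ (closed-⁻¹ σ∈G) (closed-∘ τ∈G σ∈G))

  transposable-isEquivalence : B.IsEquivalence (Transposable G)
  transposable-isEquivalence = record
    { refl  = inj₁ refl
    ; sym   = transposable-sym
    ; trans = transposable-trans
    }
    where
    transposable-sym : B.Symmetric (Transposable G)
    transposable-sym         (inj₁ i≡j) = inj₁ (sym i≡j)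
    transposable-sym {i} {j} (inj₂ ij∈G) = inj₂ (respects (transpose-comm i j) ij∈G)

    transposable-trans : B.Transitive (Transposable G)
    transposable-trans (inj₁ refl) r          = r
    transposable-trans (inj₂ ij∈G) (inj₁ refl) = inj₂ ij∈G
    transposable-trans {i} {j} {k} (inj₂ ij∈G) (inj₂ jk∈G) with i ≟ k | k ≟ j
    ... | yes i≡k | _        = inj₁ i≡k
    ... | no _    | yes refl = inj₂ ij∈G
    ... | no i≢k  | no k≢j   =
      inj₂ (subst₂ (λ a b → G (transpose a b)) (transpose-matchʳ i j)
                   (transpose-fix i j (i≢k ∘ sym) k≢j) (conjugate-transpose-∈ ij∈G jk∈G))

  transposable-map : ∀ {σ i j} → G σ → Transposable G i j →
                     Transposable G (σ ⟨$⟩ʳ i) (σ ⟨$⟩ʳ j)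
  transposable-map σ∈G (inj₁ refl) = inj₁ refl
  transposable-map σ∈G (inj₂ ij∈G) = inj₂ (conjugate-transpose-∈ σ∈G ij∈G)

  transposable-unmap : ∀ {σ i j} → G σ → Transposable G (σ ⟨$⟩ʳ i) (σ ⟨$⟩ʳ j) →
                       Transposable G i j
  transposable-unmap {σ} σ∈G r =
    subst₂ (Transposable G) (inverseˡ σ) (inverseˡ σ) (transposable-map (closed-⁻¹ σ∈G) r)

  count-transposable-invariant : (G? : ∀ σ → Dec (G σ)) → ∀ {σ} → G σ → ∀ i →
    count (transposable? G? (σ ⟨$⟩ʳ i)) ≡ count (transposable? G? i)
  count-transposable-invariant G? {σ} σ∈G i = begin
    count (transposable? G? (σ ⟨$⟩ʳ i))
      ≡⟨ count-permute _ σ ⟨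
    count (transposable? G? (σ ⟨$⟩ʳ i) ∘ (σ ⟨$⟩ʳ_))
      ≡⟨ count-cong _ (transposable? G? i) (transposable-unmap σ∈G , transposable-map σ∈G) ⟩
    count (transposable? G? i)
      ∎
    where open ≡-Reasoning

count-transposable-zero : {G : Permutation′ (suc N) → Set} (G? : ∀ σ → Dec (G σ)) →
                          count (transposable? G? zero) ≡ suc (transpCount G G?)
count-transposable-zero G? =
  trans (count-suc (transposable? G? zero))
        (cong₂ _+_ (indicator-yes (inj₁ refl) (transposable? G? zero zero))
                   (count-cong _ (λ i → G? (transpose zero (suc i)))
                               ((λ { (inj₁ ()) ; (inj₂ g) → g }) , inj₂)))

lemma2 : (n m : ℕ) (G : Permutation′ (suc n) → Set) (G? : ∀ σ → Dec (G σ)) →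
         IsSubgroup G → IsTransitive G → transpCount G G? ≡ m →
         suc m ∣ suc n
lemma2 n m G G? G-sub G-transitive refl =
  subst (suc m ∣_) (length-tabulate (λ i → i))
        (∣length-of-equal-classes (transposable? G?) (transposable-isEquivalence G-sub)
                                   (suc m) (allFin (suc n)) (λ {i} _ → classSize i))
  where
  classSize : ∀ i → count (transposable? G? i) ≡ suc m
  classSize i with G-transitive zero i
  ... | σ , σ∈G , refl =
    trans (count-transposable-invariant G-sub G? σ∈G zero) (count-transposable-zero G?)
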